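{- Let $G$ be a finite graph of order $2k$ that is vertex-transitive, twin-free, and has co-twins, and let $\kappa:\mathrm{Aut}(G)\to S_k$ send each automorphism to the permutation it induces on the set of $k$ co-twin pairs. Then $\kappa$ is surjective if and only if $G$ is triangle-free.
   Context: $N(u)$ is the open and $N[u]=N(u)\cup\{u\}$ the closed neighborhood of $u$. A graph is twin-free if no two distinct vertices have equal open neighborhoods and no two distinct vertices have equal closed neighborhoods. Co-twins means nonadjacent co-twins: distinct vertices $u,v$ with $N[u]\cap N[v]=\emptyset$ and $N[u]\cup N[v]=V(G)$. In such a graph each vertex has exactly one co-twin, so $V(G)$ is partitioned into $k$ co-twin pairs, and automorphisms map co-twin pairs to co-twin pairs; $S_k$ is the symmetric group on the set of co-twin pairs. -}

module Defs where

open import Data.Nat using (ℕ)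
open import Data.Fin using (Fin)
open import Data.Fin.Permutation using (Permutation′; _⟨$⟩ʳ_)
open import Data.Bool using (Bool; true; false)
open import Data.Product using (Σ; ∃; _×_; _,_)
open import Data.Sum using (_⊎_)
open import Relation.Nullary using (¬_)
open import Relation.Binary.PropositionalEquality using (_≡_; _≢_)
open import Function.Bundles using (_⇔_)

record Graph (n : ℕ) : Set where
  field
    adj     : Fin n → Fin n → Bool
    symm    : ∀ u v → adj u v ≡ adj v u
    irrefl  : ∀ u → adj u u ≡ false

module _ {n : ℕ} (G : Graph n) where
  open Graph G

  Adj : Fin n → Fin n → Set
  Adj u v = adj u v ≡ true

  InOpen : Fin n → Fin n → Set
  InOpen u w = Adj u w

  InClosed : Fin n → Fin n → Set
  InClosed u w = (w ≡ u) ⊎ Adj u w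

  TwinFree : Set
  TwinFree = ∀ u v → u ≢ v →
    ¬ (∀ w → InOpen u w ⇔ InOpen v w) × ¬ (∀ w → InClosed u w ⇔ InClosed v w)

  CoTwin : Fin n → Fin n → Set
  CoTwin u v = (u ≢ v)
    × (∀ w → ¬ (InClosed u w × InClosed v w))
    × (∀ w → InClosed u w ⊎ InClosed v w)

  HasCoTwins : Set
  HasCoTwins = Σ (Fin n) λ u → Σ (Fin n) λ v → CoTwin u v

  IsAutomorphism : Permutation′ n → Set
  IsAutomorphism f = ∀ u v → adj (f ⟨$⟩ʳ u) (f ⟨$⟩ʳ v) ≡ adj u v

  VertexTransitive : Set
  VertexTransitive = ∀ u v → Σ (Permutation′ n) λ f → IsAutomorphism f × (f ⟨$⟩ʳ u ≡ v)

  TriangleFree : Set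
  TriangleFree = ∀ u v w → ¬ (Adj u v × Adj v w × Adj u w)

  -- A vertex permutation that maps co-twin pairs to co-twin pairs; every such σ
  -- induces a permutation of the set of co-twin pairs, and every permutation of
  -- the co-twin pairs arises from such a σ.
  PreservesCoTwinPairs : Permutation′ n → Set
  PreservesCoTwinPairs σ = ∀ u v → CoTwin u v → CoTwin (σ ⟨$⟩ʳ u) (σ ⟨$⟩ʳ v)

  -- f and σ induce the same permutation of co-twin pairs:
  -- f v lies in the co-twin pair {σ v, co-twin of σ v} for every vertex v.
  SamePairAction : Permutation′ n → Permutation′ n → Set
  SamePairAction f σ = ∀ v → (f ⟨$⟩ʳ v ≡ σ ⟨$⟩ʳ v) ⊎ CoTwin (f ⟨$⟩ʳ v) (σ ⟨$⟩ʳ v)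

  KappaSurjective : Set
  KappaSurjective = ∀ σ → PreservesCoTwinPairs σ →
    Σ (Permutation′ n) λ f → IsAutomorphism f × SamePairAction f σ

{-# OPTIONS --safe #-}
module Submission where

-- Twin-freeness makes co-twins unique, so (every vertex having a co-twin by vertex transitivity)
-- v ↦ ct v is a fixed-point-free involution whose orbits are the co-twin pairs.
--
-- If G is triangle-free, fix a co-twin pair u₀, ct u₀. Then {u₀} ∪ N(ct u₀) and {ct u₀} ∪ N(u₀) are
-- independent halves of V(G) exchanged by ct, and u ~ v iff u, v lie in opposite halves and v ≠ ct u.
-- A permutation σ of the pairs is therefore realised by the automorphism sending v to the vertex of
-- the pair of σ v that lies in the half of v.
--
-- Conversely, let a, b, c be a triangle. As N[a] ≠ N[b], some d is adjacent to exactly one of a, b,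
-- and d lies outside the pairs of a, b and c. Let f be an automorphism inducing the transposition of
-- the pairs of c and d. Replacing a vertex by its co-twin toggles its adjacency to every vertex
-- outside its pair, so the adjacent vertices f a, f b are a, b or ct a, ct b, and each vertex of the
-- pair of d is adjacent to exactly one of them; hence f c cannot be adjacent to both.

open import Defs
open import Data.Nat using (ℕ; _*_)
open import Data.Bool using (Bool; true; false; not)
open import Data.Bool.Properties using (¬-not; not-¬; not-involutive; not-injective; ⇔→≡) renaming (_≟_ to _≟ᵇ_)
open import Data.Empty using (⊥; ⊥-elim)
open import Data.Fin using (Fin)
open import Data.Fin.Properties using (_≟_; ¬∀⟶∃¬)
open import Data.Fin.Permutation
  using (Permutation′; _⟨$⟩ʳ_; _⟨$⟩ˡ_; inverseˡ; inverseʳ; permutation; flip; _∘ₚ_; transpose)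
import Data.Fin.Permutation.Components as PC
open import Data.Product using (∃; _×_; _,_; proj₁; proj₂)
import Data.Product as Product
open import Data.Sum using (_⊎_; inj₁; inj₂; [_,_])
import Data.Sum as Sum
open import Function.Base using (_∘_)
open import Function.Bundles using (_⇔_; mk⇔; Equivalence; Injection)
open import Function.Definitions using (Injective)
open import Function.Properties.Inverse using (↔⇒↣)
open import Relation.Nullary using (¬_; Dec; yes; no; does)
open import Relation.Nullary.Decidable using (dec-true; dec-false; decidable-stable; _⊎-dec_)
open import Relation.Binary.PropositionalEquality
  using (_≡_; _≢_; refl; sym; trans; cong; cong₂; subst; subst₂; module ≡-Reasoning)

⟨$⟩ʳ-injective : ∀ {n} (π : Permutation′ n) → Injective _≡_ _≡_ (π ⟨$⟩ʳ_)
⟨$⟩ʳ-injective π = Injection.injective (↔⇒↣ π)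

module _ {n : ℕ} where

  transpose-matchˡ : (i j : Fin n) → PC.transpose i j i ≡ j
  transpose-matchˡ i j rewrite dec-true (i ≟ i) refl = refl

  transpose-matchʳ : (i j : Fin n) → PC.transpose i j j ≡ i
  transpose-matchʳ i j with j ≟ i
  ... | yes refl = refl
  ... | no _ rewrite dec-true (j ≟ j) refl = refl

  transpose-mismatch : ∀ {i j k : Fin n} → k ≢ i → k ≢ j → PC.transpose i j k ≡ k
  transpose-mismatch {i} {j} {k} k≢i k≢j rewrite dec-false (k ≟ i) k≢i | dec-false (k ≟ j) k≢j = refl

  transpose-equivariant : ∀ {g : Fin n → Fin n} → Injective _≡_ _≡_ g → ∀ i j k →
                          g (PC.transpose i j k) ≡ PC.transpose (g i) (g j) (g k)
  transpose-equivariant {g} g-inj i j k = by-cases (k ≟ i) (k ≟ j)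
    where
    by-cases : Dec (k ≡ i) → Dec (k ≡ j) → g (PC.transpose i j k) ≡ PC.transpose (g i) (g j) (g k)
    by-cases (yes refl) _ = trans (cong g (transpose-matchˡ k j)) (sym (transpose-matchˡ (g k) (g j)))
    by-cases (no _) (yes refl) = trans (cong g (transpose-matchʳ i k)) (sym (transpose-matchʳ (g i) (g k)))
    by-cases (no k≢i) (no k≢j) =
      trans (cong g (transpose-mismatch k≢i k≢j)) (sym (transpose-mismatch (k≢i ∘ g-inj) (k≢j ∘ g-inj)))

  transpose-comm : ∀ {i j k l : Fin n} → k ≢ i → k ≢ j → l ≢ i → l ≢ j → ∀ v →
                   PC.transpose i j (PC.transpose k l v) ≡ PC.transpose k l (PC.transpose i j v)
  transpose-comm {i} {j} {k} {l} k≢i k≢j l≢i l≢j v = by-cases (v ≟ k) (v ≟ l) (v ≟ i) (v ≟ j)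
    where
    open ≡-Reasoning
    by-cases : Dec (v ≡ k) → Dec (v ≡ l) → Dec (v ≡ i) → Dec (v ≡ j) →
               PC.transpose i j (PC.transpose k l v) ≡ PC.transpose k l (PC.transpose i j v)
    by-cases (yes refl) _ _ _ = begin
      PC.transpose i j (PC.transpose v l v)  ≡⟨ cong (PC.transpose i j) (transpose-matchˡ v l) ⟩
      PC.transpose i j l                     ≡⟨ transpose-mismatch l≢i l≢j ⟩
      l                                      ≡⟨ transpose-matchˡ v l ⟨
      PC.transpose v l v                     ≡⟨ cong (PC.transpose v l) (transpose-mismatch k≢i k≢j) ⟨
      PC.transpose v l (PC.transpose i j v)  ∎
    by-cases (no _) (yes refl) _ _ = begin
      PC.transpose i j (PC.transpose k v v)  ≡⟨ cong (PC.transpose i j) (transpose-matchʳ k v) ⟩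
      PC.transpose i j k                     ≡⟨ transpose-mismatch k≢i k≢j ⟩
      k                                      ≡⟨ transpose-matchʳ k v ⟨
      PC.transpose k v v                     ≡⟨ cong (PC.transpose k v) (transpose-mismatch l≢i l≢j) ⟨
      PC.transpose k v (PC.transpose i j v)  ∎
    by-cases (no v≢k) (no v≢l) (yes refl) _ = begin
      PC.transpose v j (PC.transpose k l v)  ≡⟨ cong (PC.transpose v j) (transpose-mismatch v≢k v≢l) ⟩
      PC.transpose v j v                     ≡⟨ transpose-matchˡ v j ⟩
      j                                      ≡⟨ transpose-mismatch (k≢j ∘ sym) (l≢j ∘ sym) ⟨
      PC.transpose k l j                     ≡⟨ cong (PC.transpose k l) (transpose-matchˡ v j) ⟨
      PC.transpose k l (PC.transpose v j v)  ∎
    by-cases (no v≢k) (no v≢l) (no _) (yes refl) = begin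
      PC.transpose i v (PC.transpose k l v)  ≡⟨ cong (PC.transpose i v) (transpose-mismatch v≢k v≢l) ⟩
      PC.transpose i v v                     ≡⟨ transpose-matchʳ i v ⟩
      i                                      ≡⟨ transpose-mismatch (k≢i ∘ sym) (l≢i ∘ sym) ⟨
      PC.transpose k l i                     ≡⟨ cong (PC.transpose k l) (transpose-matchʳ i v) ⟨
      PC.transpose k l (PC.transpose i v v)  ∎
    by-cases (no v≢k) (no v≢l) (no v≢i) (no v≢j) = begin
      PC.transpose i j (PC.transpose k l v)  ≡⟨ cong (PC.transpose i j) (transpose-mismatch v≢k v≢l) ⟩
      PC.transpose i j v                     ≡⟨ transpose-mismatch v≢i v≢j ⟩
      v                                      ≡⟨ transpose-mismatch v≢k v≢l ⟨
      PC.transpose k l v                     ≡⟨ cong (PC.transpose k l) (transpose-mismatch v≢i v≢j) ⟨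
      PC.transpose k l (PC.transpose i j v)  ∎

module CoTwins {n : ℕ} (G : Graph n) where
  open Graph G

  Adj-sym : ∀ {u v} → Adj G u v → Adj G v u
  Adj-sym {u} {v} uv = trans (symm v u) uv

  Adj-irrefl : ∀ {u} → ¬ Adj G u u
  Adj-irrefl {u} uu with trans (sym (irrefl u)) uu
  ... | ()

  Adj⇒≢ : ∀ {u v} → Adj G u v → u ≢ v
  Adj⇒≢ uv refl = Adj-irrefl uv

  CoTwin-sym : ∀ {x y} → CoTwin G x y → CoTwin G y x
  CoTwin-sym (x≢y , disjoint , cover) =
    x≢y ∘ sym , (λ w → disjoint w ∘ Product.swap) , Sum.swap ∘ cover

  CoTwin⇒¬Adj : ∀ {x y} → CoTwin G x y → ¬ Adj G x y
  CoTwin⇒¬Adj {y = y} (_ , disjoint , _) xy = disjoint y (inj₂ xy , inj₁ refl)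

  CoTwin⇒¬commonNeighbour : ∀ {x y w} → CoTwin G x y → Adj G x w → Adj G y w → ⊥
  CoTwin⇒¬commonNeighbour {w = w} (_ , disjoint , _) xw yw = disjoint w (inj₂ xw , inj₂ yw)

  CoTwin-cover : ∀ {x y w} → CoTwin G x y → w ≢ x → w ≢ y → Adj G x w ⊎ Adj G y w
  CoTwin-cover {w = w} (_ , _ , cover) w≢x w≢y with cover w
  ... | inj₁ (inj₁ w≡x) = ⊥-elim (w≢x w≡x)
  ... | inj₁ (inj₂ xw)  = inj₁ xw
  ... | inj₂ (inj₁ w≡y) = ⊥-elim (w≢y w≡y)
  ... | inj₂ (inj₂ yw)  = inj₂ yw

  SamePair : Fin n → Fin n → Set
  SamePair x y = x ≡ y ⊎ CoTwin G x y

  SamePair-sym : ∀ {x y} → SamePair x y → SamePair y x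
  SamePair-sym = Sum.map sym CoTwin-sym

  Adj⇒¬SamePair : ∀ {x y} → Adj G x y → ¬ SamePair x y
  Adj⇒¬SamePair xy = [ Adj⇒≢ xy , (λ x≈y → CoTwin⇒¬Adj x≈y xy) ]

  CoTwin-adj-flip : ∀ {x y w} → CoTwin G x y → ¬ SamePair x w → adj y w ≡ not (adj x w)
  CoTwin-adj-flip {x} xy x≁w = ¬-not λ same →
    [ (λ xw → CoTwin⇒¬commonNeighbour xy xw (trans same xw))
    , (λ yw → CoTwin⇒¬commonNeighbour xy (trans (sym same) yw) yw)
    ] (CoTwin-cover xy (x≁w ∘ inj₁ ∘ sym) (λ w≡y → x≁w (inj₂ (subst (CoTwin G x) (sym w≡y) xy))))

  CoTwin-unique : TwinFree G → ∀ {u v v′} → CoTwin G u v → CoTwin G u v′ → v ≡ v′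
  CoTwin-unique twinFree {v = v} {v′} uv uv′ = decidable-stable (v ≟ v′) λ v≢v′ →
    proj₂ (twinFree v v′ v≢v′) λ w → mk⇔ (closed⊆ uv uv′ w) (closed⊆ uv′ uv w)
    where
    closed⊆ : ∀ {u v v′} → CoTwin G u v → CoTwin G u v′ → ∀ w → InClosed G v w → InClosed G v′ w
    closed⊆ (_ , disjoint , _) (_ , _ , cover) w vw =
      [ (λ uw → ⊥-elim (disjoint w (uw , vw))) , (λ v′w → v′w) ] (cover w)

  module _ (g : Permutation′ n) (isAut : IsAutomorphism G g) where

    private
      g⁺ = g ⟨$⟩ʳ_
      g⁻ = g ⟨$⟩ˡ_

    Automorphism-InClosed : ∀ {u w} → InClosed G u w → InClosed G (g⁺ u) (g⁺ w)
    Automorphism-InClosed (inj₁ w≡u) = inj₁ (cong g⁺ w≡u)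
    Automorphism-InClosed {u} {w} (inj₂ uw) = inj₂ (trans (isAut u w) uw)

    Automorphism-InClosed⁻ : ∀ {u w} → InClosed G (g⁺ u) w → InClosed G u (g⁻ w)
    Automorphism-InClosed⁻ {u} {w} (inj₁ w≡gu) = inj₁ (⟨$⟩ʳ-injective g (trans (inverseʳ g) w≡gu))
    Automorphism-InClosed⁻ {u} {w} (inj₂ gu-w) =
      inj₂ (trans (sym (isAut u (g⁻ w))) (subst (Adj G (g⁺ u)) (sym (inverseʳ g)) gu-w))

    Automorphism-CoTwin : ∀ {u v} → CoTwin G u v → CoTwin G (g⁺ u) (g⁺ v)
    Automorphism-CoTwin {u} {v} (u≢v , disjoint , cover) =
      u≢v ∘ ⟨$⟩ʳ-injective g ,
      (λ w → λ (uw , vw) → disjoint (g⁻ w) (Automorphism-InClosed⁻ uw , Automorphism-InClosed⁻ vw)) ,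
      (λ w → subst (λ w → InClosed G (g⁺ u) w ⊎ InClosed G (g⁺ v) w) (inverseʳ g)
               (Sum.map Automorphism-InClosed Automorphism-InClosed (cover (g⁻ w))))

  PreservesCoTwinPairs⇒SamePair : ∀ σ → PreservesCoTwinPairs G σ →
                                  ∀ {x y} → SamePair x y → SamePair (σ ⟨$⟩ʳ x) (σ ⟨$⟩ʳ y)
  PreservesCoTwinPairs⇒SamePair σ preserves = Sum.map (cong (σ ⟨$⟩ʳ_)) (preserves _ _)

  vertexTransitive⇒coTwins : VertexTransitive G → HasCoTwins G → ∀ v → ∃ (CoTwin G v)
  vertexTransitive⇒coTwins transitive (u , u′ , uu′) v with transitive u v
  ... | g , isAut , refl = g ⟨$⟩ʳ u′ , Automorphism-CoTwin g isAut uu′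

module CoTwinMap {n : ℕ} (G : Graph n) (twinFree : TwinFree G) (coTwin : ∀ v → ∃ (CoTwin G v)) where
  open CoTwins G

  ct : Fin n → Fin n
  ct = proj₁ ∘ coTwin

  CoTwin-ct : ∀ v → CoTwin G v (ct v)
  CoTwin-ct = proj₂ ∘ coTwin

  CoTwin⇒≡ct : ∀ {u v} → CoTwin G u v → v ≡ ct u
  CoTwin⇒≡ct uv = CoTwin-unique twinFree uv (CoTwin-ct _)

  ct-involutive : ∀ v → ct (ct v) ≡ v
  ct-involutive v = sym (CoTwin⇒≡ct (CoTwin-sym (CoTwin-ct v)))

  ct-injective : Injective _≡_ _≡_ ct
  ct-injective {x} {y} e = trans (sym (ct-involutive x)) (trans (cong ct e) (ct-involutive y))

  SamePair-trans : ∀ {x y z} → SamePair x y → SamePair y z → SamePair x z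
  SamePair-trans (inj₁ refl) y≈z = y≈z
  SamePair-trans (inj₂ x≈y) (inj₁ refl) = inj₂ x≈y
  SamePair-trans (inj₂ x≈y) (inj₂ y≈z) = inj₁ (CoTwin-unique twinFree (CoTwin-sym x≈y) y≈z)

  ¬SamePair⇒≢ct : ∀ {x y} → ¬ SamePair x y → y ≢ ct x
  ¬SamePair⇒≢ct x≁y y≡ct-x = x≁y (inj₂ (subst (CoTwin G _) (sym y≡ct-x) (CoTwin-ct _)))

  module _ (σ : Permutation′ n) where

    private
      σ⁺ = σ ⟨$⟩ʳ_
      σ⁻ = σ ⟨$⟩ˡ_

    ct-commute⇒PreservesCoTwinPairs : (∀ v → σ⁺ (ct v) ≡ ct (σ⁺ v)) → PreservesCoTwinPairs G σ
    ct-commute⇒PreservesCoTwinPairs commute u v uv =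
      subst (CoTwin G (σ⁺ u)) (sym (trans (cong σ⁺ (CoTwin⇒≡ct uv)) (commute u))) (CoTwin-ct (σ⁺ u))

    PreservesCoTwinPairs-flip : PreservesCoTwinPairs G σ → PreservesCoTwinPairs G (flip σ)
    PreservesCoTwinPairs-flip preserves u v uv = subst (CoTwin G (σ⁻ u)) ct-σ⁻u≡σ⁻v (CoTwin-ct (σ⁻ u))
      where
      σ-ct-σ⁻u≡v : σ⁺ (ct (σ⁻ u)) ≡ v
      σ-ct-σ⁻u≡v = CoTwin-unique twinFree
        (subst (λ w → CoTwin G w (σ⁺ (ct (σ⁻ u)))) (inverseʳ σ) (preserves _ _ (CoTwin-ct (σ⁻ u)))) uv
      ct-σ⁻u≡σ⁻v : ct (σ⁻ u) ≡ σ⁻ v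
      ct-σ⁻u≡σ⁻v = trans (sym (inverseˡ σ)) (cong σ⁻ σ-ct-σ⁻u≡v)

  module PairSwap {c d : Fin n} (c≁d : ¬ SamePair c d) where

    pairSwap : Permutation′ n
    pairSwap = transpose c d ∘ₚ transpose (ct c) (ct d)

    private
      t₁ = PC.transpose c d
      t₂ = PC.transpose (ct c) (ct d)

      ct-t₁ : ∀ w → ct (t₁ w) ≡ t₂ (ct w)
      ct-t₁ = transpose-equivariant ct-injective c d

      ct-t₂ : ∀ w → ct (t₂ w) ≡ t₁ (ct w)
      ct-t₂ w = trans (transpose-equivariant ct-injective (ct c) (ct d) w)
                      (cong₂ (λ i j → PC.transpose i j (ct w)) (ct-involutive c) (ct-involutive d))

      ct-c≢c : ct c ≢ c
      ct-c≢c = proj₁ (CoTwin-ct c) ∘ sym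

      ct-d≢d : ct d ≢ d
      ct-d≢d = proj₁ (CoTwin-ct d) ∘ sym

      ct-c≢d : ct c ≢ d
      ct-c≢d = ¬SamePair⇒≢ct c≁d ∘ sym

      ct-d≢c : ct d ≢ c
      ct-d≢c = ¬SamePair⇒≢ct (c≁d ∘ SamePair-sym) ∘ sym

    pairSwap-ct : ∀ v → pairSwap ⟨$⟩ʳ ct v ≡ ct (pairSwap ⟨$⟩ʳ v)
    pairSwap-ct v = begin
      t₂ (t₁ (ct v))  ≡⟨ transpose-comm ct-c≢c ct-c≢d ct-d≢c ct-d≢d (ct v) ⟨
      t₁ (t₂ (ct v))  ≡⟨ cong t₁ (ct-t₁ v) ⟨
      t₁ (ct (t₁ v))  ≡⟨ ct-t₂ (t₁ v) ⟨
      ct (t₂ (t₁ v))  ∎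
      where open ≡-Reasoning

    pairSwap-PreservesCoTwinPairs : PreservesCoTwinPairs G pairSwap
    pairSwap-PreservesCoTwinPairs = ct-commute⇒PreservesCoTwinPairs pairSwap pairSwap-ct

    pairSwap-c : pairSwap ⟨$⟩ʳ c ≡ d
    pairSwap-c = trans (cong t₂ (transpose-matchˡ c d)) (transpose-mismatch (ct-c≢d ∘ sym) (ct-d≢d ∘ sym))

    pairSwap-fixes : ∀ {v} → ¬ SamePair c v → ¬ SamePair d v → pairSwap ⟨$⟩ʳ v ≡ v
    pairSwap-fixes c≁v d≁v = trans (cong t₂ (transpose-mismatch (c≁v ∘ inj₁ ∘ sym) (d≁v ∘ inj₁ ∘ sym)))
                                   (transpose-mismatch (¬SamePair⇒≢ct c≁v) (¬SamePair⇒≢ct d≁v))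

module KappaSurjective⇒TriangleFree {n : ℕ} (G : Graph n) (twinFree : TwinFree G)
                                    (coTwin : ∀ v → ∃ (CoTwin G v)) where
  open Graph G
  open CoTwins G
  open CoTwinMap G twinFree coTwin

  Separates : Fin n → Fin n → Fin n → Set
  Separates w x y = adj x w ≢ adj y w

  adjacent⇒separatingVertex : ∀ {a b} → Adj G a b → ∃ λ d → d ≢ a × d ≢ b × Separates d a b
  adjacent⇒separatingVertex {a} {b} ab =
    let d , ¬Pd = ¬∀⟶∃¬ n P P? (proj₂ (twinFree a b (Adj⇒≢ ab)) ∘ closedTwins)
    in d , ¬Pd ∘ inj₁ ∘ inj₁ , ¬Pd ∘ inj₁ ∘ inj₂ , ¬Pd ∘ inj₂
    where
    P : Fin n → Set
    P w = (w ≡ a ⊎ w ≡ b) ⊎ adj a w ≡ adj b w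
    P? : ∀ w → Dec (P w)
    P? w = ((w ≟ a) ⊎-dec (w ≟ b)) ⊎-dec (adj a w ≟ᵇ adj b w)
    transfer : ∀ {x y w} → Adj G y x → (w ≡ x ⊎ w ≡ y) ⊎ adj x w ≡ adj y w →
               InClosed G x w → InClosed G y w
    transfer yx _                  (inj₁ refl) = inj₂ yx
    transfer yx (inj₁ (inj₁ refl)) (inj₂ _)    = inj₂ yx
    transfer yx (inj₁ (inj₂ w≡y))  (inj₂ _)    = inj₁ w≡y
    transfer yx (inj₂ same)        (inj₂ xw)   = inj₂ (trans (sym same) xw)
    closedTwins : (∀ w → P w) → ∀ w → InClosed G a w ⇔ InClosed G b w
    closedTwins allP w = mk⇔ (transfer (Adj-sym ab) (allP w))
                             (transfer ab (Sum.map Sum.swap sym (allP w)))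

  separating⇒¬CoTwin : ∀ {a b d} → Adj G a b → Separates d a b → ¬ CoTwin G a d
  separating⇒¬CoTwin {a} {b} {d} ab sep ad = CoTwin⇒¬commonNeighbour ad ab (Adj-sym bd)
    where
    bd : Adj G b d
    bd = trans (¬-not (sep ∘ sym)) (cong not (¬-not (CoTwin⇒¬Adj ad)))

  separating⇒¬SamePair : ∀ {a b d} → Adj G a b → d ≢ a → Separates d a b → ¬ SamePair a d
  separating⇒¬SamePair ab d≢a sep = [ d≢a ∘ sym , separating⇒¬CoTwin ab sep ]

  commonNeighbourPair⇒¬Separates : ∀ {a b c d} → Adj G a c → Adj G b c → SamePair c d → ¬ Separates d a b
  commonNeighbourPair⇒¬Separates ac bc (inj₁ refl) sep = sep (trans ac (sym bc))
  commonNeighbourPair⇒¬Separates {c = c} {d} ac bc (inj₂ cd) sep =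
    sep (trans (¬-not (¬adj ac)) (sym (¬-not (¬adj bc))))
    where
    ¬adj : ∀ {x} → Adj G x c → ¬ Adj G x d
    ¬adj xc xd = CoTwin⇒¬commonNeighbour cd (Adj-sym xc) (Adj-sym xd)

  Separates-CoTwins : ∀ {w x x′ y y′} → CoTwin G x x′ → CoTwin G y y′ → ¬ SamePair x w → ¬ SamePair y w →
                      Separates w x y → Separates w x′ y′
  Separates-CoTwins xx′ yy′ x≁w y≁w sep same =
    sep (not-injective (trans (sym (CoTwin-adj-flip xx′ x≁w)) (trans same (CoTwin-adj-flip yy′ y≁w))))

  Separates-CoTwin : ∀ {w w′ x y} → CoTwin G w w′ → ¬ SamePair w x → ¬ SamePair w y →
                     Separates w x y → Separates w′ x y
  Separates-CoTwin {w} {w′} ww′ w≁x w≁y sep same =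
    sep (not-injective (trans (sym (flip-at w≁x)) (trans same (flip-at w≁y))))
    where
    flip-at : ∀ {x} → ¬ SamePair w x → adj x w′ ≡ not (adj x w)
    flip-at {x} w≁x = trans (symm x w′) (trans (CoTwin-adj-flip ww′ w≁x) (cong not (symm w x)))

  adjacentRepresentatives : ∀ {a b A B} → Adj G a b → SamePair A a → SamePair B b → Adj G A B →
                            (A ≡ a × B ≡ b) ⊎ (CoTwin G A a × CoTwin G B b)
  adjacentRepresentatives _  (inj₁ A≡a) (inj₁ B≡b) _  = inj₁ (A≡a , B≡b)
  adjacentRepresentatives ab (inj₁ refl) (inj₂ Bb) AB =
    ⊥-elim (CoTwin⇒¬commonNeighbour Bb (Adj-sym AB) (Adj-sym ab))
  adjacentRepresentatives ab (inj₂ Aa) (inj₁ refl) AB = ⊥-elim (CoTwin⇒¬commonNeighbour Aa AB ab)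
  adjacentRepresentatives _  (inj₂ Aa) (inj₂ Bb) _    = inj₂ (Aa , Bb)

  ¬triangleOverSeparatingPair : ∀ {a b d A B C} → Adj G a b → Separates d a b →
                                ¬ SamePair a d → ¬ SamePair b d → SamePair A a → SamePair B b → SamePair C d →
                                ¬ (Adj G A B × Adj G B C × Adj G A C)
  ¬triangleOverSeparatingPair {d = d} {A} {B} ab sep a≁d b≁d Aa Bb Cd (AB , BC , AC) =
    separates-C Cd (trans AC (sym BC))
    where
    separates-d : (A ≡ _ × B ≡ _) ⊎ (CoTwin G A _ × CoTwin G B _) → Separates d A B
    separates-d (inj₁ (A≡a , B≡b)) = subst₂ (Separates d) (sym A≡a) (sym B≡b) sep
    separates-d (inj₂ (Aa′ , Bb′)) = Separates-CoTwins (CoTwin-sym Aa′) (CoTwin-sym Bb′) a≁d b≁d sep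
    d≁ : ∀ {X x} → SamePair X x → ¬ SamePair x d → ¬ SamePair d X
    d≁ Xx x≁d dX = x≁d (SamePair-sym (SamePair-trans dX Xx))
    separates-C : ∀ {C} → SamePair C d → Separates C A B
    separates-C (inj₁ refl) = separates-d (adjacentRepresentatives ab Aa Bb AB)
    separates-C (inj₂ Cd′)  =
      Separates-CoTwin (CoTwin-sym Cd′) (d≁ Aa a≁d) (d≁ Bb b≁d) (separates-C (inj₁ refl))

  kappaSurjective⇒triangleFree : KappaSurjective G → TriangleFree G
  kappaSurjective⇒triangleFree surjective a b c (ab , bc , ac) =
    let d , d≢a , d≢b , sep = adjacent⇒separatingVertex ab
        a≁d = separating⇒¬SamePair ab d≢a sep
        b≁d = separating⇒¬SamePair (Adj-sym ab) d≢b (sep ∘ sym)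
        open PairSwap (λ cd → commonNeighbourPair⇒¬Separates ac bc cd sep)
        f , isAut , sameAction = surjective pairSwap pairSwap-PreservesCoTwinPairs
        f⁺ = f ⟨$⟩ʳ_
        fixed : ∀ {x} → Adj G x c → ¬ SamePair x d → SamePair (f⁺ x) x
        fixed xc x≁d = subst (SamePair (f⁺ _)) (pairSwap-fixes (Adj⇒¬SamePair (Adj-sym xc)) (x≁d ∘ SamePair-sym))
                             (sameAction _)
        preserves : ∀ {x y} → Adj G x y → Adj G (f⁺ x) (f⁺ y)
        preserves {x} {y} xy = trans (isAut x y) xy
    in ¬triangleOverSeparatingPair ab sep a≁d b≁d (fixed ac a≁d) (fixed bc b≁d)
         (subst (SamePair (f⁺ c)) pairSwap-c (sameAction c)) (preserves ab , preserves bc , preserves ac)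

module TriangleFree⇒KappaSurjective {n : ℕ} (G : Graph n) (twinFree : TwinFree G) (coTwin : ∀ v → ∃ (CoTwin G v))
                                    (triangleFree : TriangleFree G) (u₀ : Fin n) where
  open Graph G
  open CoTwins G
  open CoTwinMap G twinFree coTwin

  Half : Fin n → Fin n → Fin n → Set
  Half x y v = v ≡ x ⊎ Adj G y v

  Half? : ∀ x y v → Dec (Half x y v)
  Half? x y v = (v ≟ x) ⊎-dec (adj y v ≟ᵇ true)

  Half-complement : ∀ {x y v} → CoTwin G x y → ¬ Half x y v → Half y x v
  Half-complement {y = y} {v} xy ¬half with v ≟ y
  ... | yes v≡y = inj₁ v≡y
  ... | no v≢y = [ inj₂ , ⊥-elim ∘ ¬half ∘ inj₂ ] (CoTwin-cover xy (¬half ∘ inj₁) v≢y)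

  Half-disjoint : ∀ {x y v} → CoTwin G x y → Half x y v → ¬ Half y x v
  Half-disjoint (x≢y , _) (inj₁ refl) (inj₁ v≡y) = x≢y v≡y
  Half-disjoint xy        (inj₁ refl) (inj₂ xx)  = Adj-irrefl xx
  Half-disjoint xy        (inj₂ yy)   (inj₁ refl) = Adj-irrefl yy
  Half-disjoint xy        (inj₂ yv)   (inj₂ xv)  = CoTwin⇒¬commonNeighbour xy xv yv

  Half-independent : ∀ {x y u v} → CoTwin G x y → Half x y u → Half x y v → ¬ Adj G u v
  Half-independent xy (inj₁ refl) (inj₁ refl) uu = Adj-irrefl uu
  Half-independent xy (inj₁ refl) (inj₂ yv)   xv = CoTwin⇒¬commonNeighbour xy xv yv
  Half-independent xy (inj₂ yu)   (inj₁ refl) ux = CoTwin⇒¬commonNeighbour xy (Adj-sym ux) yu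
  Half-independent xy (inj₂ yu)   (inj₂ yv)   uv = triangleFree _ _ _ (yu , uv , yv)

  Half-ct : ∀ {x y v} → CoTwin G x y → Half x y v → Half y x (ct v)
  Half-ct xy (inj₁ refl) = inj₁ (sym (CoTwin⇒≡ct xy))
  Half-ct {x} {y} {v} xy (inj₂ yv) =
    [ (λ vx → ⊥-elim (CoTwin⇒¬commonNeighbour xy (Adj-sym vx) yv)) , inj₂ ∘ Adj-sym ]
    (CoTwin-cover (CoTwin-ct v) x≢v x≢ct-v)
    where
    x≢v : x ≢ v
    x≢v refl = CoTwin⇒¬Adj (CoTwin-sym xy) yv
    x≢ct-v : x ≢ ct v
    x≢ct-v refl = Adj-irrefl (subst (Adj G y) (CoTwin-unique twinFree (CoTwin-sym (CoTwin-ct v)) xy) yv)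

  pole : Bool → Fin n
  pole true  = u₀
  pole false = ct u₀

  CoTwin-poles : ∀ b → CoTwin G (pole b) (pole (not b))
  CoTwin-poles true  = CoTwin-ct u₀
  CoTwin-poles false = CoTwin-sym (CoTwin-ct u₀)

  HalfOf : Bool → Fin n → Set
  HalfOf b = Half (pole b) (pole (not b))

  side : Fin n → Bool
  side v = does (Half? u₀ (ct u₀) v)

  side-spec : ∀ v → HalfOf (side v) v
  side-spec v = halfOf-does (Half? u₀ (ct u₀) v)
    where
    halfOf-does : (half? : Dec (HalfOf true v)) → HalfOf (does half?) v
    halfOf-does (yes half) = half
    halfOf-does (no ¬half) = Half-complement (CoTwin-poles true) ¬half

  side-unique : ∀ {b v} → HalfOf b v → side v ≡ b
  side-unique {true}  {v} half = dec-true (Half? u₀ (ct u₀) v) half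
  side-unique {false} {v} half = dec-false (Half? u₀ (ct u₀) v) (Half-disjoint (CoTwin-poles false) half)

  side-ct : ∀ v → side (ct v) ≡ not (side v)
  side-ct v = side-unique (HalfOf-ct (side v) (side-spec v))
    where
    HalfOf-ct : ∀ b → HalfOf b v → HalfOf (not b) (ct v)
    HalfOf-ct true  = Half-ct (CoTwin-poles true)
    HalfOf-ct false = Half-ct (CoTwin-poles false)

  sameSide⇒¬Adj : ∀ {u v} → side u ≡ side v → ¬ Adj G u v
  sameSide⇒¬Adj {u} {v} same =
    Half-independent (CoTwin-poles (side v)) (subst (λ b → HalfOf b u) same (side-spec u)) (side-spec v)

  Adj⇔oppositeSides : ∀ {u v} → Adj G u v ⇔ (side u ≢ side v × v ≢ ct u)
  Adj⇔oppositeSides {u} {v} = mk⇔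
    (λ uv → (λ same → sameSide⇒¬Adj same uv)
          , (λ v≡ct-u → CoTwin⇒¬Adj (CoTwin-ct u) (subst (Adj G u) v≡ct-u uv)))
    (λ (sides , v≢ct-u) →
      [ (λ uv → uv)
      , (λ ct-u-v → ⊥-elim (sameSide⇒¬Adj (trans (side-ct u) (sym (¬-not (sides ∘ sym)))) ct-u-v))
      ] (CoTwin-cover (CoTwin-ct u) (sides ∘ cong side ∘ sym) v≢ct-u))

  SamePair-side-injective : ∀ {z z′} → SamePair z z′ → side z ≡ side z′ → z ≡ z′
  SamePair-side-injective (inj₁ z≡z′) _ = z≡z′
  SamePair-side-injective {z} (inj₂ zz′) same =
    ⊥-elim (not-¬ refl (trans same (trans (cong side (CoTwin⇒≡ct zz′)) (side-ct z))))

  align : Bool → Fin n → Fin n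
  align b w with side w ≟ᵇ b
  ... | yes _ = w
  ... | no _  = ct w

  side-align : ∀ b w → side (align b w) ≡ b
  side-align b w with side w ≟ᵇ b
  ... | yes same = same
  ... | no differ = trans (side-ct w) (trans (cong not (¬-not differ)) (not-involutive b))

  align-SamePair : ∀ b w → SamePair (align b w) w
  align-SamePair b w with side w ≟ᵇ b
  ... | yes _ = inj₁ refl
  ... | no _  = inj₂ (CoTwin-sym (CoTwin-ct w))

  align-unique : ∀ {b z w} → SamePair z w → side z ≡ b → align b w ≡ z
  align-unique {b} {z} {w} zw side-z =
    SamePair-side-injective (SamePair-trans (align-SamePair b w) (SamePair-sym zw)) (trans (side-align b w) (sym side-z))

  align-side : ∀ w → align (side w) w ≡ w
  align-side w = align-unique (inj₁ refl) refl

  align-cong : ∀ {b w w′} → SamePair w w′ → align b w′ ≡ align b w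
  align-cong {b} {w} ww′ = align-unique (SamePair-trans (align-SamePair b w) ww′) (side-align b w)

  align-not : ∀ b w → align (not b) w ≡ ct (align b w)
  align-not b w = align-unique (SamePair-trans (inj₂ (CoTwin-sym (CoTwin-ct _))) (align-SamePair b w))
                               (trans (side-ct (align b w)) (cong not (side-align b w)))

  module _ (σ : Permutation′ n) (preserves : PreservesCoTwinPairs G σ) where

    private
      σ⁺ = σ ⟨$⟩ʳ_

    realign : Fin n → Fin n
    realign v = align (side v) (σ⁺ v)

    realign-ct : ∀ v → realign (ct v) ≡ ct (realign v)
    realign-ct v = begin
      align (side (ct v)) (σ⁺ (ct v))  ≡⟨ cong (λ b → align b (σ⁺ (ct v))) (side-ct v) ⟩
      align (not (side v)) (σ⁺ (ct v)) ≡⟨ align-cong (PreservesCoTwinPairs⇒SamePair σ preserves v≈ct-v) ⟩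
      align (not (side v)) (σ⁺ v)      ≡⟨ align-not (side v) (σ⁺ v) ⟩
      ct (align (side v) (σ⁺ v))       ∎
      where
      open ≡-Reasoning
      v≈ct-v : SamePair v (ct v)
      v≈ct-v = inj₂ (CoTwin-ct v)

  realign-inverse : ∀ σ τ (σ-preserves : PreservesCoTwinPairs G σ) (τ-preserves : PreservesCoTwinPairs G τ) →
                    (∀ v → τ ⟨$⟩ʳ (σ ⟨$⟩ʳ v) ≡ v) →
                    ∀ v → realign τ τ-preserves (realign σ σ-preserves v) ≡ v
  realign-inverse σ τ σ-preserves τ-preserves τσ≡id v = begin
    align (side r) (τ⁺ r)       ≡⟨ cong (λ b → align b (τ⁺ r)) (side-align (side v) (σ⁺ v)) ⟩
    align (side v) (τ⁺ r)       ≡⟨ align-cong (PreservesCoTwinPairs⇒SamePair τ τ-preserves r≈σ-v) ⟨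
    align (side v) (τ⁺ (σ⁺ v))  ≡⟨ cong (align (side v)) (τσ≡id v) ⟩
    align (side v) v            ≡⟨ align-side v ⟩
    v                           ∎
    where
    open ≡-Reasoning
    σ⁺ = σ ⟨$⟩ʳ_
    τ⁺ = τ ⟨$⟩ʳ_
    r = realign σ σ-preserves v
    r≈σ-v : SamePair r (σ⁺ v)
    r≈σ-v = align-SamePair (side v) (σ⁺ v)

  realignment : (σ : Permutation′ n) → PreservesCoTwinPairs G σ → Permutation′ n
  realignment σ preserves = permutation (realign σ preserves) (realign (flip σ) preserves⁻)
    (realign-inverse (flip σ) σ preserves⁻ preserves (λ _ → inverseʳ σ))
    (realign-inverse σ (flip σ) preserves preserves⁻ (λ _ → inverseˡ σ))
    where
    preserves⁻ = PreservesCoTwinPairs-flip σ preserves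

  side-ct-respecting⇒IsAutomorphism : (f : Permutation′ n) → (∀ v → side (f ⟨$⟩ʳ v) ≡ side v) →
                                        (∀ v → f ⟨$⟩ʳ ct v ≡ ct (f ⟨$⟩ʳ v)) → IsAutomorphism G f
  side-ct-respecting⇒IsAutomorphism f f-side f-ct u v = ⇔→≡ (mk⇔ to from)
    where
    f⁺ = f ⟨$⟩ʳ_
    to : Adj G (f⁺ u) (f⁺ v) → Adj G u v
    to fu-fv =
      let sides , fv≢ct-fu = Equivalence.to Adj⇔oppositeSides fu-fv
      in Equivalence.from Adj⇔oppositeSides
           ( (λ same → sides (trans (f-side u) (trans same (sym (f-side v)))))
           , (λ v≡ct-u → fv≢ct-fu (trans (cong f⁺ v≡ct-u) (f-ct u))) )
    from : Adj G u v → Adj G (f⁺ u) (f⁺ v)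
    from uv =
      let sides , v≢ct-u = Equivalence.to Adj⇔oppositeSides uv
      in Equivalence.from Adj⇔oppositeSides
           ( (λ same → sides (trans (sym (f-side u)) (trans same (f-side v))))
           , (λ fv≡ct-fu → v≢ct-u (⟨$⟩ʳ-injective f (trans fv≡ct-fu (sym (f-ct u))))) )

  triangleFree⇒kappaSurjective : KappaSurjective G
  triangleFree⇒kappaSurjective σ preserves =
    realignment σ preserves , isAutomorphism , λ v → align-SamePair (side v) (σ ⟨$⟩ʳ v)
    where
    isAutomorphism : IsAutomorphism G (realignment σ preserves)
    isAutomorphism = side-ct-respecting⇒IsAutomorphism (realignment σ preserves)
                       (λ v → side-align (side v) (σ ⟨$⟩ʳ v)) (realign-ct σ preserves)

proposition36 : (k : ℕ) (G : Graph (2 * k)) →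
    VertexTransitive G → TwinFree G → HasCoTwins G →
    (KappaSurjective G ⇔ TriangleFree G)
proposition36 k G transitive twinFree hasCoTwins@(u₀ , _) = mk⇔
  (KappaSurjective⇒TriangleFree.kappaSurjective⇒triangleFree G twinFree coTwin)
  (λ triangleFree → TriangleFree⇒KappaSurjective.triangleFree⇒kappaSurjective G twinFree coTwin triangleFree u₀)
  where
  coTwin = CoTwins.vertexTransitive⇒coTwins G transitive hasCoTwins
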